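{- Let $\ell\ge0$ be an integer, $\epsilon r+1\le j\le(1+\epsilon)r-1$, $t=p(j+r\ell)$, and let $s\ge0$ be an integer with $s+d-1\le pd(\ell+1)-1$. Assume $p>d(N+\epsilon)r$ for some integer $N\ge1$. Then $D_H^t(s)=(d(t-r)-rs)f_d\neq0$.
   Context: $p$ is a prime, $\overline{F}\in\mathbb{F}_q[x]$ ($q=p^n$) is squarefree of degree $d$, $F\in\mathbb{Z}_q[x]$ is a lift of degree $d$ with leading coefficient $f_d$ (a unit of $\mathbb{Z}_q$), $r\ge2$, $\delta=\gcd(r,d)$, $\epsilon=0$ if $\delta=1$ and $\epsilon=1$ if $\delta>1$. For integers $s,t$, $D_H^t(s)=(d(t-r)-rs)f_d$ is the scalar appearing in the horizontal reduction $D_H^t(s)\,\omega\sim M_H^t(s)\,\omega$ for differentials $\omega=G(x)x^sy^{ -t}dx$ with $\deg G\le d-1$. -}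

module Defs where

open import Level using (Level)
open import Data.Nat as ℕ using (ℕ; zero; suc)
open import Data.Nat.GCD using (gcd)
open import Data.Integer as ℤ using (ℤ; +_; -[1+_])
open import Data.Product using (∃)
open import Relation.Binary.PropositionalEquality using (_≡_)
open import Relation.Nullary using (¬_)
open import Algebra.Bundles using (CommutativeRing)

epsilon : ℕ → ℕ → ℕ
epsilon r d with gcd r d
... | 1 = 0
... | _ = 1

-- D_H^t(s) as an integer, without the factor f_d: d(t - r) - r s
DHint : (d r t s : ℕ) → ℤ
DHint d r t s = (+ d) ℤ.* ((+ t) ℤ.- (+ r)) ℤ.- (+ r) ℤ.* (+ s)

module _ {c ℓ : Level} (R : CommutativeRing c ℓ) where
  open CommutativeRing R

  natR : ℕ → Carrier
  natR zero = 0#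
  natR (suc n) = 1# + natR n

  intR : ℤ → Carrier
  intR (+ n) = natR n
  intR -[1+ n ] = - natR (suc n)

  CharZero : Set ℓ
  CharZero = ∀ (z : ℤ) → intR z ≈ 0# → z ≡ + 0

  IsUnit : Carrier → Set (c Level.⊔ ℓ)
  IsUnit x = ∃ λ y → x * y ≈ 1#

  DH : (d r t s : ℕ) → Carrier → Carrier
  DH d r t s fd = intR (DHint d r t s) * fd

module Submission where

-- Since f_d is a unit and R has characteristic zero, D_H^t(s) ≈ 0 would force the
-- integer d(t − r) − rs to vanish, i.e. r(s + d) = p · d(j + rℓ) in ℕ.  As r < p and
-- p is prime, p divides s + d; writing s + d = m p, the bound s + d ≤ pd(ℓ + 1)
-- gives m ≤ d(ℓ + 1), and cancelling p leaves r m = d(j + rℓ).  This equation has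
-- two consequences: j ≤ r (from the bound on m) and r ∣ d j.  If ε = 1 then j ≥ r + 1
-- contradicts the first; if ε = 0 then gcd(r, d) = 1, so r ∣ j with 0 < j < r,
-- contradicting the second.

open import Defs
open import Level using (Level)
open import Data.Nat using (ℕ; _+_; _*_; _≤_; _<_)
open import Data.Nat.Primality using (Prime)
open import Data.Integer as ℤ using (+_)
open import Relation.Nullary using (¬_)
open import Algebra.Bundles using (CommutativeRing)

open import Data.Nat as ℕ using (suc; NonZero; z≤n; s≤s)
open import Data.Nat.Properties
open import Data.Nat.Divisibility using (_∣_; divides; ∣⇒≤; ∣m+n∣m⇒∣n; n∣m*n)
open import Data.Nat.Primality using (euclidsLemma)
open import Data.Nat.GCD using (gcd)
open import Data.Nat.Coprimality using (coprime-divisor; gcd≡1⇒coprime)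
import Data.Integer.Properties as ℤP
open import Data.Sum using (_⊎_; inj₁; inj₂)
open import Data.Product using (_×_; _,_)
open import Data.Empty using (⊥; ⊥-elim)
open import Relation.Binary.PropositionalEquality
  using (_≡_; refl; sym; trans; cong; cong₂; subst₂; module ≡-Reasoning)
import Data.Nat.Solver as ℕSolver
import Data.Integer.Solver as ℤSolver
import Relation.Binary.Reasoning.Setoid as SetoidReasoning

unit-cancel : ∀ {c ℓ} (R : CommutativeRing c ℓ) {x u : CommutativeRing.Carrier R} →
  IsUnit R u → CommutativeRing._≈_ R (CommutativeRing._*_ R x u) (CommutativeRing.0# R) →
  CommutativeRing._≈_ R x (CommutativeRing.0# R)
unit-cancel R {x} {u} (v , uv≈1) xu≈0 = begin
  x              ≈⟨ R.sym (R.*-identityʳ x) ⟩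
  x R.* R.1#     ≈⟨ R.*-congˡ (R.sym uv≈1) ⟩
  x R.* (u R.* v)  ≈⟨ R.sym (R.*-assoc x u v) ⟩
  (x R.* u) R.* v  ≈⟨ R.*-congʳ xu≈0 ⟩
  R.0# R.* v     ≈⟨ R.zeroˡ v ⟩
  R.0#           ∎
  where
  module R = CommutativeRing R
  open SetoidReasoning R.setoid

epsilon-cases : ∀ r d → (epsilon r d ≡ 0 × gcd r d ≡ 1) ⊎ epsilon r d ≡ 1
epsilon-cases r d with gcd r d
... | 0 = inj₂ refl
... | 1 = inj₁ (refl , refl)
... | suc (suc _) = inj₂ refl

DHint-zero : ∀ d r t s → DHint d r t s ≡ + 0 → d * t ≡ r * s + d * r
DHint-zero d r t s vanishes = ℤP.+-injective (begin
  + (d * t)                                        ≡⟨ ℤP.pos-* d t ⟩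
  + d ℤ.* + t                                      ≡⟨ rearrange (+ d) (+ r) (+ t) (+ s) ⟩
  DHint d r t s ℤ.+ (+ r ℤ.* + s ℤ.+ + d ℤ.* + r)  ≡⟨ cong (ℤ._+ (+ r ℤ.* + s ℤ.+ + d ℤ.* + r)) vanishes ⟩
  + 0 ℤ.+ (+ r ℤ.* + s ℤ.+ + d ℤ.* + r)            ≡⟨ ℤP.+-identityˡ _ ⟩
  + r ℤ.* + s ℤ.+ + d ℤ.* + r                      ≡⟨ cong₂ ℤ._+_ (sym (ℤP.pos-* r s)) (sym (ℤP.pos-* d r)) ⟩
  + (r * s) ℤ.+ + (d * r)                          ≡⟨ sym (ℤP.pos-+ (r * s) (d * r)) ⟩
  + (r * s + d * r)                                ∎)
  where
  open ≡-Reasoning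
  open ℤSolver.+-*-Solver
  rearrange : ∀ D R T S → D ℤ.* T ≡ (D ℤ.* (T ℤ.- R) ℤ.- R ℤ.* S) ℤ.+ (R ℤ.* S ℤ.+ D ℤ.* R)
  rearrange = solve 4 (λ D R T S → D :* T := (D :* (T :- R) :- R :* S) :+ (R :* S :+ D :* R)) refl

int-pred-cancel-≤ : ∀ m n → + m ℤ.- + 1 ℤ.≤ + n ℤ.- + 1 → m ≤ n
int-pred-cancel-≤ m n le = ℤP.drop‿+≤+
  (subst₂ ℤ._≤_ (minus-plus-one (+ m)) (minus-plus-one (+ n)) (ℤP.+-monoˡ-≤ (+ 1) le))
  where
  open ℤSolver.+-*-Solver
  minus-plus-one : ∀ x → x ℤ.- + 1 ℤ.+ + 1 ≡ x
  minus-plus-one = solve 1 (λ x → x :- con (+ 1) :+ con (+ 1) := x) refl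

prime-divides-cofactor : ∀ {p r n} → Prime p → 0 < r → r < p → p ∣ r * n → p ∣ n
prime-divides-cofactor {r = r} {n} pp r>0 r<p p∣rn with euclidsLemma r n pp p∣rn
... | inj₂ p∣n = p∣n
... | inj₁ p∣r = ⊥-elim (<⇒≱ r<p (∣⇒≤ {{ℕ.>-nonZero r>0}} p∣r))

module _ {p r n k b : ℕ} (pp : Prime p) (r>0 : 0 < r) (r<p : r < p)
         (n≤pb : n ≤ p * b) (rn≡pk : r * n ≡ p * k) where

  private
    instance
      p≢0 : NonZero p
      p≢0 = ℕ.>-nonZero (<-trans r>0 r<p)

    p∣n : p ∣ n
    p∣n = prime-divides-cofactor pp r>0 r<p (divides k (trans rn≡pk (*-comm p k)))

  cofactor : ℕ
  cofactor = _∣_.quotient p∣n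

  cofactor-bound : cofactor ≤ b
  cofactor-bound = *-cancelʳ-≤ cofactor b p
    (≤-trans (≤-reflexive (sym (_∣_.equality p∣n))) (≤-trans n≤pb (≤-reflexive (*-comm p b))))

  cofactor-equation : r * cofactor ≡ k
  cofactor-equation = *-cancelʳ-≡ (r * cofactor) k p (begin
    r * cofactor * p    ≡⟨ *-assoc r cofactor p ⟩
    r * (cofactor * p)  ≡⟨ cong (r *_) (sym (_∣_.equality p∣n)) ⟩
    r * n               ≡⟨ rn≡pk ⟩
    p * k               ≡⟨ *-comm p k ⟩
    k * p               ∎)
    where open ≡-Reasoning

equation-bounds-j : ∀ {r d j ℓ m} → 0 < d → r * m ≡ d * (j + r * ℓ) → m ≤ d * (ℓ + 1) → j ≤ r
equation-bounds-j {r} {d} {j} {ℓ} {m} d>0 rm≡ m≤ =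
  *-cancelˡ-≤ d {{ℕ.>-nonZero d>0}} (+-cancelʳ-≤ (d * (r * ℓ)) (d * j) (d * r) (begin
    d * j + d * (r * ℓ)    ≡⟨ sym (*-distribˡ-+ d j (r * ℓ)) ⟩
    d * (j + r * ℓ)        ≡⟨ sym rm≡ ⟩
    r * m                  ≤⟨ *-monoʳ-≤ r m≤ ⟩
    r * (d * (ℓ + 1))      ≡⟨ solve 3 (λ r d l → r :* (d :* (l :+ con 1)) := d :* r :+ d :* (r :* l)) refl r d ℓ ⟩
    d * r + d * (r * ℓ)    ∎))
  where
  open ≤-Reasoning
  open ℕSolver.+-*-Solver

equation-divides-j : ∀ {r d j ℓ m} → gcd r d ≡ 1 → r * m ≡ d * (j + r * ℓ) → r ∣ j
equation-divides-j {r} {d} {j} {ℓ} {m} coprime rm≡ =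
  coprime-divisor (gcd≡1⇒coprime coprime) (∣m+n∣m⇒∣n r∣sum (n∣m*n (d * ℓ)))
  where
  open ℕSolver.+-*-Solver
  r∣sum : r ∣ d * ℓ * r + d * j
  r∣sum = divides m (begin
    d * ℓ * r + d * j   ≡⟨ solve 4 (λ d j r l → d :* l :* r :+ d :* j := d :* (j :+ r :* l)) refl d j r ℓ ⟩
    d * (j + r * ℓ)     ≡⟨ sym rm≡ ⟩
    r * m               ≡⟨ *-comm r m ⟩
    m * r               ∎)
    where open ≡-Reasoning

no-j-in-range : ∀ {r d j ℓ m} → 0 < d → r * m ≡ d * (j + r * ℓ) → m ≤ d * (ℓ + 1) →
  epsilon r d * r + 1 ≤ j → j + 1 ≤ (1 + epsilon r d) * r → ⊥
no-j-in-range {r} {d} {j} d>0 rm≡ m≤ j-low j-high with epsilon-cases r d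
... | inj₂ ε≡1 rewrite ε≡1 =
  <⇒≱ (≤-trans (≤-reflexive (+-comm 1 r)) (subst₂ _≤_ (cong (_+ 1) (+-identityʳ r)) refl j-low))
      (equation-bounds-j d>0 rm≡ m≤)
... | inj₁ (ε≡0 , coprime) rewrite ε≡0 =
  <⇒≱ j<r (∣⇒≤ {{ℕ.>-nonZero j-low}} (equation-divides-j coprime rm≡))
  where
  j<r : j < r
  j<r = ≤-trans (≤-reflexive (+-comm 1 j)) (subst₂ _≤_ refl (+-identityʳ r) j-high)

lemma4p3 : ∀ {c ℓ' : Level} (R : CommutativeRing c ℓ') → CharZero R →
    (p d r N ℓ j s : ℕ) (fd : CommutativeRing.Carrier R) →
    Prime p → 1 ≤ d → 2 ≤ r → 1 ≤ N → IsUnit R fd →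
    epsilon r d * r + 1 ≤ j → j + 1 ≤ (1 + epsilon r d) * r →
    (+ s) ℤ.+ (+ d) ℤ.- (+ 1) ℤ.≤ (+ (p * d * (ℓ + 1))) ℤ.- (+ 1) →
    d * (N + epsilon r d) * r < p →
    ¬ (CommutativeRing._≈_ R (DH R d r (p * (j + r * ℓ)) s fd) (CommutativeRing.0# R))
lemma4p3 R charZero p d r N ℓ j s fd pp d≥1 r≥2 N≥1 fd-unit j-low j-high s-bound p-large DH≈0 =
  no-j-in-range {r} {d} {j} {ℓ} d≥1 (cofactor-equation pp r>0 r<p s+d≤ equation) (cofactor-bound pp r>0 r<p s+d≤ equation)
    j-low j-high
  where
  open ℕSolver.+-*-Solver
  r>0 : 0 < r
  r>0 = <-trans (s≤s z≤n) r≥2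
  -- r ≤ d (N + ε) r < p, since d ≥ 1 and N ≥ 1.
  r<p : r < p
  r<p = ≤-<-trans (m≤n*m r (d * (N + epsilon r d)) {{ℕ.>-nonZero (*-mono-≤ d≥1 (≤-trans N≥1 (m≤m+n N _)))}})
          p-large
  s+d≤ : s + d ≤ p * (d * (ℓ + 1))
  s+d≤ = subst₂ _≤_ refl (*-assoc p d (ℓ + 1))
           (int-pred-cancel-≤ (s + d) _ (subst₂ ℤ._≤_ (cong (ℤ._- + 1) (sym (ℤP.pos-+ s d))) refl s-bound))
  -- Characteristic zero and invertibility of f_d turn D_H^t(s) ≈ 0 into r(s + d) = p · d(j + rℓ).
  equation : r * (s + d) ≡ p * (d * (j + r * ℓ))
  equation = trans (solve 3 (λ r s d → r :* (s :+ d) := r :* s :+ d :* r) refl r s d)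
    (trans (sym (DHint-zero d r (p * (j + r * ℓ)) s (charZero _ (unit-cancel R fd-unit DH≈0))))
      (solve 4 (λ d p j rl → d :* (p :* (j :+ rl)) := p :* (d :* (j :+ rl))) refl d p j (r * ℓ)))
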